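{- Let $\mathbf A$ be an SBP-algebra. For every ultrafilter $\mathfrak u$ of $\mathcal B(\mathbf A)$, $R_{\mathfrak u}=R_{\mathfrak u}^*$.
   Context: **SBP-algebras.** An MTL-algebra is a bounded commutative integral residuated lattice $(A,\wedge,\vee,\cdot,\to,0,1)$ with distributive lattice reduct satisfying $(a\to b)\vee(b\to a)=1$. Write $\neg a=a\to0$. An SBP-algebra is an MTL-algebra satisfying $\neg(a^2)\to(\neg\neg a\to a)=1$ and $(2a)^2=2(a^2)$, where $a^2=a\cdot a$ and $2a=\neg(\neg a\cdot\neg a)$. **Notation.** - The radical is $\mathcal R(\mathbf A)=\{x:\neg x<x\}$. - The Boolean skeleton is $\mathcal B(\mathbf A)=\{u:u\vee\neg u=1\}$. - $R_{\mathfrak u}$ denotes the lattice filter of $\mathbf A$ generated by $\mathfrak u\cup\mathcal R(\mathbf A)$. - For a subset $F\subseteq A$, $F^*=\{a\in A:\neg a\notin F\}$. -}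

module Defs where

open import Level using (Level; _⊔_) renaming (suc to lsuc; zero to lzero)
open import Data.Product using (_×_; Σ; _,_)
open import Data.Sum using (_⊎_)
open import Relation.Nullary using (¬_)
open import Relation.Binary.PropositionalEquality using (_≡_; _≢_)

record MTLAlgebra : Set₁ where
  infixr 5 _→'_
  infixl 7 _·_
  infixl 6 _∧_
  infixl 5 _∨_
  field
    Carrier : Set
    _∧_ _∨_ _·_ _→'_ : Carrier → Carrier → Carrier
    𝟘 𝟙 : Carrier
    ∧-comm   : ∀ a b → a ∧ b ≡ b ∧ a
    ∨-comm   : ∀ a b → a ∨ b ≡ b ∨ a
    ∧-assoc  : ∀ a b c → (a ∧ b) ∧ c ≡ a ∧ (b ∧ c)
    ∨-assoc  : ∀ a b c → (a ∨ b) ∨ c ≡ a ∨ (b ∨ c)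
    ∧-absorb : ∀ a b → a ∧ (a ∨ b) ≡ a
    ∨-absorb : ∀ a b → a ∨ (a ∧ b) ≡ a
    ∧-distrib-∨ : ∀ a b c → a ∧ (b ∨ c) ≡ (a ∧ b) ∨ (a ∧ c)
    𝟘-bottom : ∀ a → 𝟘 ∧ a ≡ 𝟘
    𝟙-top    : ∀ a → a ∧ 𝟙 ≡ a
    ·-comm   : ∀ a b → a · b ≡ b · a
    ·-assoc  : ∀ a b c → (a · b) · c ≡ a · (b · c)
    ·-identity : ∀ a → a · 𝟙 ≡ a
    -- residuation:  a · b ≤ c  iff  a ≤ b → c   (x ≤ y defined as x ∧ y ≡ x)
    residuation₁ : ∀ a b c → (a · b) ∧ c ≡ a · b → a ∧ (b →' c) ≡ a
    residuation₂ : ∀ a b c → a ∧ (b →' c) ≡ a → (a · b) ∧ c ≡ a · b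
    prelinearity : ∀ a b → (a →' b) ∨ (b →' a) ≡ 𝟙

  _≤_ : Carrier → Carrier → Set
  a ≤ b = a ∧ b ≡ a

  _<_ : Carrier → Carrier → Set
  a < b = a ≤ b × a ≢ b

  ¬' : Carrier → Carrier
  ¬' a = a →' 𝟘

  _² : Carrier → Carrier
  a ² = a · a

  2× : Carrier → Carrier
  2× a = ¬' (¬' a · ¬' a)

record SBPAlgebra : Set₁ where
  field
    mtl : MTLAlgebra
  open MTLAlgebra mtl
  field
    sbp₁ : ∀ a → ¬' (a ²) →' (¬' (¬' a) →' a) ≡ 𝟙
    sbp₂ : ∀ a → (2× a) ² ≡ 2× (a ²)
  open MTLAlgebra mtl public

module _ (A : MTLAlgebra) where
  open MTLAlgebra A

  Subset : Set₁
  Subset = Carrier → Set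

  Radical : Subset
  Radical x = ¬' x < x

  BoolSkel : Subset
  BoolSkel u = u ∨ ¬' u ≡ 𝟙

  record IsProperFilterOfB (F : Subset) : Set where
    field
      inB      : ∀ {x} → F x → BoolSkel x
      has-𝟙    : F 𝟙
      up-close : ∀ {x y} → F x → BoolSkel y → x ≤ y → F y
      ∧-close  : ∀ {x y} → F x → F y → F (x ∧ y)
      proper   : ¬ F 𝟘

  record IsUltrafilterOfB (𝔲 : Subset) : Set₁ where
    field
      isFilter : IsProperFilterOfB 𝔲
      maximal  : ∀ (G : Subset) → IsProperFilterOfB G →
                 (∀ {x} → 𝔲 x → G x) → ∀ {x} → G x → 𝔲 x

  data GenFilter (S : Subset) : Subset where
    base : ∀ {x} → S x → GenFilter S x
    top  : GenFilter S 𝟙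
    up   : ∀ {x y} → GenFilter S x → x ≤ y → GenFilter S y
    meet : ∀ {x y} → GenFilter S x → GenFilter S y → GenFilter S (x ∧ y)

  R[_] : Subset → Subset
  R[ 𝔲 ] = GenFilter (λ x → 𝔲 x ⊎ Radical x)

  _* : Subset → Subset
  (F *) a = ¬ F (¬' a)

module Submission where

open import Defs
open import Algebra.Bundles using (CommutativeSemigroup)
import Algebra.Properties.CommutativeSemigroup as CommutativeSemigroupProperties
open import Data.Product using (_×_; _,_; Σ; proj₁)
open import Data.Sum using (inj₁; inj₂)
open import Relation.Binary.Bundles using (Poset)
open import Relation.Binary.PropositionalEquality
  using (_≡_; _≢_; refl; sym; trans; cong; cong₂; subst; isEquivalence)
open import Relation.Nullary using (¬_)

-- Every element of R_𝔲 lies above some u ∧ t with u ∈ 𝔲 and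
-- 2t = 1, a property closed under meets. If a and ¬a both lay in R_𝔲, then
-- (u t)² ≤ a ¬a = 0; as u is idempotent, u ≤ ¬(t²), and the SBP identity
-- (2t)² = 2(t²) makes ¬(t²) square to 0, so u = 0 ∈ 𝔲, which is absurd.
-- Conversely, b = (2a)² is Boolean by prelinearity, a ∨ ¬a is radical, and
-- b ∧ (a ∨ ¬a) ≤ a while ¬b ∧ (a ∨ ¬a) ≤ ¬a. The ultrafilter contains b or
-- ¬b; the second would put ¬a in R_𝔲, so if ¬a ∉ R_𝔲 then a ∈ R_𝔲.

module MTLProperties (A : MTLAlgebra) where
  open MTLAlgebra A hiding (_≤_)

  infix 4 _≤_
  _≤_ : Carrier → Carrier → Set
  _≤_ = MTLAlgebra._≤_ A

  ∧-idem : ∀ a → a ∧ a ≡ a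
  ∧-idem a = trans (cong (a ∧_) (sym (∨-absorb a a))) (∧-absorb a (a ∧ a))

  ≤-reflexive : ∀ {a b} → a ≡ b → a ≤ b
  ≤-reflexive {a} refl = ∧-idem a

  ≤-refl : ∀ {a} → a ≤ a
  ≤-refl = ≤-reflexive refl

  ≤-trans : ∀ {a b c} → a ≤ b → b ≤ c → a ≤ c
  ≤-trans {a} {b} {c} p q =
    trans (cong (_∧ c) (sym p)) (trans (∧-assoc a b c) (trans (cong (a ∧_) q) p))

  ≤-antisym : ∀ {a b} → a ≤ b → b ≤ a → a ≡ b
  ≤-antisym {a} {b} p q = trans (sym p) (trans (∧-comm a b) q)

  ≤-poset : Poset _ _ _
  ≤-poset = record
    { Carrier = Carrier
    ; _≈_ = _≡_
    ; _≤_ = _≤_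
    ; isPartialOrder = record
      { isPreorder = record
        { isEquivalence = isEquivalence
        ; reflexive = ≤-reflexive
        ; trans = ≤-trans
        }
      ; antisym = ≤-antisym
      }
    }

  open import Relation.Binary.Reasoning.PartialOrder ≤-poset public

  x∧y≤x : ∀ {a b} → a ∧ b ≤ a
  x∧y≤x {a} {b} = trans (∧-assoc a b a) (trans (cong (a ∧_) (∧-comm b a))
    (trans (sym (∧-assoc a a b)) (cong (_∧ b) (∧-idem a))))

  x∧y≤y : ∀ {a b} → a ∧ b ≤ b
  x∧y≤y {a} {b} = trans (∧-assoc a b b) (cong (a ∧_) (∧-idem b))

  ∧-greatest : ∀ {x a b} → x ≤ a → x ≤ b → x ≤ a ∧ b
  ∧-greatest {x} {a} {b} p q = trans (sym (∧-assoc x a b)) (trans (cong (_∧ b) p) q)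

  ∧-mono : ∀ {a b c d} → a ≤ b → c ≤ d → a ∧ c ≤ b ∧ d
  ∧-mono p q = ∧-greatest (≤-trans x∧y≤x p) (≤-trans x∧y≤y q)

  x≤x∨y : ∀ {a b} → a ≤ a ∨ b
  x≤x∨y {a} {b} = ∧-absorb a b

  y≤x∨y : ∀ {a b} → b ≤ a ∨ b
  y≤x∨y {a} {b} = subst (b ≤_) (∨-comm b a) x≤x∨y

  ∨-least : ∀ {a b c} → a ≤ c → b ≤ c → a ∨ b ≤ c
  ∨-least {a} {b} {c} p q = trans (cong ((a ∨ b) ∧_) (sym a∨b∨c≡c)) (∧-absorb (a ∨ b) c)
    where
    join : ∀ {x y} → x ≤ y → x ∨ y ≡ y
    join {x} {y} p = trans (cong (_∨ y) (sym p))
      (trans (∨-comm (x ∧ y) y) (trans (cong (y ∨_) (∧-comm x y)) (∨-absorb y x)))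
    a∨b∨c≡c : a ∨ b ∨ c ≡ c
    a∨b∨c≡c = trans (∨-assoc a b c) (trans (cong (a ∨_) (join q)) (join p))

  𝟘≤x : ∀ {a} → 𝟘 ≤ a
  𝟘≤x {a} = 𝟘-bottom a

  x≤𝟙 : ∀ {a} → a ≤ 𝟙
  x≤𝟙 {a} = 𝟙-top a

  𝟙≤⇒≡𝟙 : ∀ {a} → 𝟙 ≤ a → a ≡ 𝟙
  𝟙≤⇒≡𝟙 p = ≤-antisym x≤𝟙 p

  ≤𝟘⇒≡𝟘 : ∀ {a} → a ≤ 𝟘 → a ≡ 𝟘
  ≤𝟘⇒≡𝟘 p = ≤-antisym p 𝟘≤x

  residual⁺ : ∀ {a b c} → a · b ≤ c → a ≤ b →' c
  residual⁺ {a} {b} {c} = residuation₁ a b c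

  residual⁻ : ∀ {a b c} → a ≤ b →' c → a · b ≤ c
  residual⁻ {a} {b} {c} = residuation₂ a b c

  →-mp : ∀ {a b} → (a →' b) · a ≤ b
  →-mp = residual⁻ ≤-refl

  ·-monoˡ : ∀ {a b c} → a ≤ b → a · c ≤ b · c
  ·-monoˡ p = residual⁻ (≤-trans p (residual⁺ ≤-refl))

  ·-monoʳ : ∀ {a b c} → a ≤ b → c · a ≤ c · b
  ·-monoʳ {a} {b} {c} p = begin
    c · a  ≡⟨ ·-comm c a ⟩
    a · c  ≤⟨ ·-monoˡ p ⟩
    b · c  ≡⟨ ·-comm b c ⟩
    c · b  ∎

  ·-mono : ∀ {a b c d} → a ≤ b → c ≤ d → a · c ≤ b · d
  ·-mono p q = ≤-trans (·-monoˡ p) (·-monoʳ q)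

  x·y≤x : ∀ {a b} → a · b ≤ a
  x·y≤x {a} {b} = ≤-trans (·-monoʳ x≤𝟙) (≤-reflexive (·-identity a))

  x·y≤y : ∀ {a b} → a · b ≤ b
  x·y≤y {a} {b} = ≤-trans (≤-reflexive (·-comm a b)) x·y≤x

  x·y≤x∧y : ∀ {a b} → a · b ≤ a ∧ b
  x·y≤x∧y = ∧-greatest x·y≤x x·y≤y

  ·-commutativeSemigroup : CommutativeSemigroup _ _
  ·-commutativeSemigroup = record
    { Carrier = Carrier
    ; _≈_ = _≡_
    ; _∙_ = _·_
    ; isCommutativeSemigroup = record
      { isSemigroup = record
        { isMagma = record { isEquivalence = isEquivalence ; ∙-cong = cong₂ _·_ }
        ; assoc = ·-assoc
        }
      ; comm = ·-comm
      }
    }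

  open CommutativeSemigroupProperties ·-commutativeSemigroup using (interchange) public

  ≤⇒→≡𝟙 : ∀ {a b} → a ≤ b → a →' b ≡ 𝟙
  ≤⇒→≡𝟙 p = 𝟙≤⇒≡𝟙 (residual⁺ (≤-trans x·y≤y p))

  →≡𝟙⇒≤ : ∀ {a b} → a →' b ≡ 𝟙 → a ≤ b
  →≡𝟙⇒≤ {a} {b} e = begin
    a      ≡⟨ sym (trans (·-comm 𝟙 a) (·-identity a)) ⟩
    𝟙 · a  ≤⟨ residual⁻ (≤-reflexive (sym e)) ⟩
    b      ∎

  x·¬x≤𝟘 : ∀ {a} → a · ¬' a ≤ 𝟘
  x·¬x≤𝟘 {a} = ≤-trans (≤-reflexive (·-comm a (¬' a))) →-mp

  ¬-antitone : ∀ {a b} → a ≤ b → ¬' b ≤ ¬' a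
  ¬-antitone p = residual⁺ (≤-trans (·-monoʳ p) →-mp)

  x≤¬¬x : ∀ {a} → a ≤ ¬' (¬' a)
  x≤¬¬x = residual⁺ x·¬x≤𝟘

  ¬𝟙≤𝟘 : ¬' 𝟙 ≤ 𝟘
  ¬𝟙≤𝟘 = ≤-trans (≤-reflexive (sym (·-identity (¬' 𝟙)))) →-mp

  ·-distribʳ-∨ : ∀ {a b c} → (b ∨ c) · a ≤ b · a ∨ c · a
  ·-distribʳ-∨ = residual⁻ (∨-least (residual⁺ x≤x∨y) (residual⁺ y≤x∨y))

  ·-distribˡ-∨ : ∀ {a b c} → a · (b ∨ c) ≤ a · b ∨ a · c
  ·-distribˡ-∨ {a} {b} {c} = begin
    a · (b ∨ c)    ≡⟨ ·-comm a (b ∨ c) ⟩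
    (b ∨ c) · a    ≤⟨ ·-distribʳ-∨ ⟩
    b · a ∨ c · a  ≡⟨ cong₂ _∨_ (·-comm b a) (·-comm c a) ⟩
    a · b ∨ a · c  ∎

  ≤-split : ∀ {z e₁ e₂} → e₁ ∨ e₂ ≡ 𝟙 → z ≤ z · e₁ ∨ z · e₂
  ≤-split {z} {e₁} {e₂} e = begin
    z              ≡⟨ sym (·-identity z) ⟩
    z · 𝟙          ≡⟨ cong (z ·_) (sym e) ⟩
    z · (e₁ ∨ e₂)  ≤⟨ ·-distribˡ-∨ ⟩
    z · e₁ ∨ z · e₂  ∎

  x·y≤x²∨y² : ∀ {a b} → a · b ≤ a ² ∨ b ²
  x·y≤x²∨y² {a} {b} = ≤-trans (≤-split (prelinearity a b)) (∨-least a→b a←b)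
    where
    a→b : (a · b) · (a →' b) ≤ a ² ∨ b ²
    a→b = begin
      (a · b) · (a →' b)  ≡⟨ trans (cong (_· (a →' b)) (·-comm a b)) (·-assoc b a (a →' b)) ⟩
      b · (a · (a →' b))  ≤⟨ ·-monoʳ (≤-trans (≤-reflexive (·-comm a (a →' b))) →-mp) ⟩
      b ²                 ≤⟨ y≤x∨y ⟩
      a ² ∨ b ²           ∎
    a←b : (a · b) · (b →' a) ≤ a ² ∨ b ²
    a←b = begin
      (a · b) · (b →' a)  ≡⟨ ·-assoc a b (b →' a) ⟩
      a · (b · (b →' a))  ≤⟨ ·-monoʳ (≤-trans (≤-reflexive (·-comm b (b →' a))) →-mp) ⟩
      a ²                 ≤⟨ x≤x∨y ⟩
      a ² ∨ b ²           ∎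

  [x∨y]²≤x²∨y² : ∀ {a b} → (a ∨ b) ² ≤ a ² ∨ b ²
  [x∨y]²≤x²∨y² {a} {b} = ≤-trans ·-distribʳ-∨ (∨-least
    (≤-trans ·-distribˡ-∨ (∨-least x≤x∨y x·y≤x²∨y²))
    (≤-trans ·-distribˡ-∨ (∨-least (≤-trans (≤-reflexive (·-comm b a)) x·y≤x²∨y²) y≤x∨y)))

  -- Combined with prelinearity (a →' b) ∨ (b →' a) ≡ 𝟙, this is the usual
  -- route to an inequality: prove it under each of the two implications.
  squares-cover-𝟙 : ∀ {e₁ e₂ t} → e₁ ∨ e₂ ≡ 𝟙 → e₁ ² ≤ t → e₂ ² ≤ t → t ≡ 𝟙
  squares-cover-𝟙 {e₁} {e₂} {t} e p q = 𝟙≤⇒≡𝟙 (begin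
    𝟙                ≡⟨ sym (trans (cong₂ _·_ e e) (·-identity 𝟙)) ⟩
    (e₁ ∨ e₂) ²      ≤⟨ [x∨y]²≤x²∨y² ⟩
    e₁ ² ∨ e₂ ²      ≤⟨ ∨-least p q ⟩
    t                ∎)

  ¬-∧ : ∀ {a b} → ¬' (a ∧ b) ≤ ¬' a ∨ ¬' b
  ¬-∧ {a} {b} = ≤-trans (≤-split (prelinearity a b)) (∨-least
    (≤-trans (residual⁺ (refute (∧-greatest x·y≤y →-mp))) x≤x∨y)
    (≤-trans (residual⁺ (refute (∧-greatest →-mp x·y≤y))) y≤x∨y))
    where
    refute : ∀ {e c} → e · c ≤ a ∧ b → (¬' (a ∧ b) · e) · c ≤ 𝟘
    refute {e} {c} p = begin
      (¬' (a ∧ b) · e) · c  ≡⟨ ·-assoc (¬' (a ∧ b)) e c ⟩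
      ¬' (a ∧ b) · (e · c)  ≤⟨ ·-monoʳ p ⟩
      ¬' (a ∧ b) · (a ∧ b)  ≤⟨ →-mp ⟩
      𝟘                     ∎

  BoolSkel⇒idempotent : ∀ {u} → BoolSkel A u → u ≤ u ²
  BoolSkel⇒idempotent e = ≤-trans (≤-split e) (∨-least ≤-refl (≤-trans x·¬x≤𝟘 𝟘≤x))

  BoolSkel-𝟙 : BoolSkel A 𝟙
  BoolSkel-𝟙 = 𝟙≤⇒≡𝟙 x≤x∨y

  BoolSkel-¬ : ∀ {a} → BoolSkel A a → BoolSkel A (¬' a)
  BoolSkel-¬ e = 𝟙≤⇒≡𝟙 (≤-trans (≤-reflexive (sym e)) (∨-least (≤-trans x≤¬¬x y≤x∨y) x≤x∨y))

  BoolSkel-∧ : ∀ {a b} → BoolSkel A a → BoolSkel A b → BoolSkel A (a ∧ b)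
  BoolSkel-∧ {a} {b} ea eb = 𝟙≤⇒≡𝟙 (begin
    𝟙                                      ≡⟨ sym (trans (cong₂ _∧_ ea eb) (𝟙-top 𝟙)) ⟩
    (a ∨ ¬' a) ∧ (b ∨ ¬' b)                ≡⟨ ∧-comm (a ∨ ¬' a) (b ∨ ¬' b) ⟩
    (b ∨ ¬' b) ∧ (a ∨ ¬' a)                ≡⟨ ∧-distrib-∨ (b ∨ ¬' b) a (¬' a) ⟩
    (b ∨ ¬' b) ∧ a ∨ (b ∨ ¬' b) ∧ ¬' a     ≡⟨ cong (_∨ (b ∨ ¬' b) ∧ ¬' a) (∧-comm (b ∨ ¬' b) a) ⟩
    a ∧ (b ∨ ¬' b) ∨ (b ∨ ¬' b) ∧ ¬' a     ≡⟨ cong (_∨ (b ∨ ¬' b) ∧ ¬' a) (∧-distrib-∨ a b (¬' b)) ⟩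
    (a ∧ b ∨ a ∧ ¬' b) ∨ (b ∨ ¬' b) ∧ ¬' a ≤⟨ ∨-least (∨-least x≤x∨y (below-¬ x∧y≤y x∧y≤y)) (below-¬ x∧y≤y x∧y≤x) ⟩
    a ∧ b ∨ ¬' (a ∧ b)                     ∎)
    where
    below-¬ : ∀ {x c} → x ≤ ¬' c → a ∧ b ≤ c → x ≤ a ∧ b ∨ ¬' (a ∧ b)
    below-¬ p q = ≤-trans p (≤-trans (¬-antitone q) y≤x∨y)

  2×≡𝟙⇒¬²≤𝟘 : ∀ {a} → 2× a ≡ 𝟙 → ¬' a ² ≤ 𝟘
  2×≡𝟙⇒¬²≤𝟘 = →≡𝟙⇒≤

  2×-𝟙 : 2× 𝟙 ≡ 𝟙
  2×-𝟙 = ≤⇒→≡𝟙 (≤-trans x·y≤x ¬𝟙≤𝟘)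

  2×-∧ : ∀ {a b} → 2× a ≡ 𝟙 → 2× b ≡ 𝟙 → 2× (a ∧ b) ≡ 𝟙
  2×-∧ ea eb = ≤⇒→≡𝟙 (≤-trans (·-mono ¬-∧ ¬-∧)
    (≤-trans [x∨y]²≤x²∨y² (∨-least (2×≡𝟙⇒¬²≤𝟘 ea) (2×≡𝟙⇒¬²≤𝟘 eb))))

  Radical⇒2×≡𝟙 : ∀ {a} → Radical A a → 2× a ≡ 𝟙
  Radical⇒2×≡𝟙 (¬a≤a , _) = ≤⇒→≡𝟙 (≤-trans (·-monoʳ ¬a≤a) →-mp)

module UltrafilterOfB (A : MTLAlgebra) {𝔲 : Subset A} (ult : IsUltrafilterOfB A 𝔲) where
  open MTLAlgebra A hiding (_≤_)
  open MTLProperties A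
  open IsUltrafilterOfB ult
  open IsProperFilterOfB isFilter

  𝟘≢𝟙 : 𝟘 ≢ 𝟙
  𝟘≢𝟙 e = proper (subst 𝔲 (sym e) has-𝟙)

  -- 𝔲 is maximal among proper filters, so it already contains the
  -- filter generated by 𝔲 ∪ {b}, which is proper as long as ¬b ∉ 𝔲.
  ¬∉⇒∈ : ∀ {b} → BoolSkel A b → ¬ 𝔲 (¬' b) → 𝔲 b
  ¬∉⇒∈ {b} bool-b ¬b∉𝔲 =
    maximal 𝔲+b 𝔲+b-filter (λ {x} x∈𝔲 → inB x∈𝔲 , x , x∈𝔲 , x∧y≤x) (bool-b , 𝟙 , has-𝟙 , x∧y≤y)
    where
    𝔲+b : Subset A
    𝔲+b y = BoolSkel A y × Σ Carrier λ u → 𝔲 u × (u ∧ b ≤ y)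
    𝔲+b-filter : IsProperFilterOfB A 𝔲+b
    𝔲+b-filter = record
      { inB = proj₁
      ; has-𝟙 = BoolSkel-𝟙 , 𝟙 , has-𝟙 , x≤𝟙
      ; up-close = λ { (_ , u , u∈𝔲 , p) bool-y q → bool-y , u , u∈𝔲 , ≤-trans p q }
      ; ∧-close = λ { (bool-x , u , u∈𝔲 , p) (bool-y , v , v∈𝔲 , q) →
          BoolSkel-∧ bool-x bool-y , u ∧ v , ∧-close u∈𝔲 v∈𝔲 ,
          ∧-greatest (≤-trans (∧-mono x∧y≤x ≤-refl) p)
                     (≤-trans (∧-mono x∧y≤y ≤-refl) q) }
      ; proper = λ { (_ , u , u∈𝔲 , p) →
          ¬b∉𝔲 (up-close u∈𝔲 (BoolSkel-¬ bool-b) (residual⁺ (≤-trans x·y≤x∧y p))) }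
      }

  record Cover (x : Carrier) : Set where
    field
      {u t}  : Carrier
      u∈𝔲    : 𝔲 u
      2t≡𝟙   : 2× t ≡ 𝟙
      u∧t≤x  : u ∧ t ≤ x

  R⇒Cover : ∀ {x} → R[_] A 𝔲 x → Cover x
  R⇒Cover (base (inj₁ x∈𝔲)) = record { u∈𝔲 = x∈𝔲 ; 2t≡𝟙 = 2×-𝟙 ; u∧t≤x = x∧y≤x }
  R⇒Cover (base (inj₂ x-radical)) =
    record { u∈𝔲 = has-𝟙 ; 2t≡𝟙 = Radical⇒2×≡𝟙 x-radical ; u∧t≤x = x∧y≤y }
  R⇒Cover top = record { u∈𝔲 = has-𝟙 ; 2t≡𝟙 = 2×-𝟙 ; u∧t≤x = x≤𝟙 }
  R⇒Cover (up x∈R p) = let c = R⇒Cover x∈R in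
    record { u∈𝔲 = Cover.u∈𝔲 c ; 2t≡𝟙 = Cover.2t≡𝟙 c ; u∧t≤x = ≤-trans (Cover.u∧t≤x c) p }
  R⇒Cover (meet x∈R y∈R) = let c = R⇒Cover x∈R ; d = R⇒Cover y∈R in record
    { u∈𝔲 = ∧-close (Cover.u∈𝔲 c) (Cover.u∈𝔲 d)
    ; 2t≡𝟙 = 2×-∧ (Cover.2t≡𝟙 c) (Cover.2t≡𝟙 d)
    ; u∧t≤x = ∧-greatest (≤-trans (∧-mono x∧y≤x x∧y≤x) (Cover.u∧t≤x c))
                         (≤-trans (∧-mono x∧y≤y x∧y≤y) (Cover.u∧t≤x d))
    }

  ∈R : ∀ {u r x} → 𝔲 u → Radical A r → u ∧ r ≤ x → R[_] A 𝔲 x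
  ∈R u∈𝔲 r-radical p = up (meet (base (inj₁ u∈𝔲)) (base (inj₂ r-radical))) p

module SBPProperties (A : SBPAlgebra) where
  open SBPAlgebra A hiding (_≤_)
  open MTLProperties mtl

  2×-² : ∀ {a} → 2× a ≡ 𝟙 → 2× (a ²) ≡ 𝟙
  2×-² {a} e = trans (sym (sbp₂ a)) (trans (cong₂ _·_ e e) (·-identity 𝟙))

  ¬-fixpoint⇒𝟘≡𝟙 : ∀ {a} → ¬' a ≡ a → 𝟘 ≡ 𝟙
  ¬-fixpoint⇒𝟘≡𝟙 {a} e = ≤-antisym 𝟘≤x (begin
    𝟙                        ≡⟨ sym (2×-² (≤⇒→≡𝟙 (≤-trans (≤-reflexive (cong₂ _·_ e e)) a²≤𝟘))) ⟩
    ¬' (¬' (a ²) · ¬' (a ²)) ≡⟨ cong (λ c → ¬' (c · c)) (≤⇒→≡𝟙 a²≤𝟘) ⟩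
    ¬' (𝟙 · 𝟙)               ≡⟨ cong ¬' (·-identity 𝟙) ⟩
    ¬' 𝟙                     ≤⟨ ¬𝟙≤𝟘 ⟩
    𝟘                        ∎)
    where
    a²≤𝟘 : a ² ≤ 𝟘
    a²≤𝟘 = ≤-trans (≤-reflexive (cong (a ·_) (sym e))) x·¬x≤𝟘

  x∨¬x-radical : ∀ {a} → 𝟘 ≢ 𝟙 → Radical mtl (a ∨ ¬' a)
  x∨¬x-radical 𝟘≢𝟙 = ≤-trans (¬-antitone x≤x∨y) y≤x∨y , λ e → 𝟘≢𝟙 (¬-fixpoint⇒𝟘≡𝟙 e)

  -- e₁ ∨ e₂ = 1 by prelinearity, and the SBP identity gives e₁² ≤ ¬((2a)²);
  -- so each inequality below is checked separately under e₁ and under e₂.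
  module _ (a : Carrier) where
    private
      b = (2× a) ²
      e₁ = a →' ¬' a
      e₂ = ¬' a →' a

      e₁²≤¬b : e₁ ² ≤ ¬' b
      e₁²≤¬b = residual⁺ (begin
        e₁ ² · b                       ≤⟨ ·-monoˡ (·-mono e₁≤¬a² e₁≤¬a²) ⟩
        ¬' (a ²) · ¬' (a ²) · b        ≡⟨ cong (¬' (a ²) · ¬' (a ²) ·_) (sbp₂ a) ⟩
        ¬' (a ²) · ¬' (a ²) · 2× (a ²) ≤⟨ x·¬x≤𝟘 ⟩
        𝟘                              ∎)
        where
        e₁≤¬a² : e₁ ≤ ¬' (a ²)
        e₁≤¬a² = residual⁺ (≤-trans (≤-reflexive (sym (·-assoc e₁ a a))) (≤-trans (·-monoˡ →-mp) →-mp))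

      e₂²≤b : e₂ ² ≤ b
      e₂²≤b = ·-mono e₂≤2a e₂≤2a
        where
        e₂≤2a : e₂ ≤ 2× a
        e₂≤2a = residual⁺ (≤-trans (≤-reflexive (sym (·-assoc e₂ (¬' a) (¬' a))))
                                   (≤-trans (·-monoˡ →-mp) x·¬x≤𝟘))

    2×²-BoolSkel : BoolSkel mtl ((2× a) ²)
    2×²-BoolSkel = squares-cover-𝟙 (prelinearity a (¬' a)) (≤-trans e₁²≤¬b y≤x∨y) (≤-trans e₂²≤b x≤x∨y)

    2×²∧[x∨¬x]≤x : (2× a) ² ∧ (a ∨ ¬' a) ≤ a
    2×²∧[x∨¬x]≤x = begin
      b ∧ (a ∨ ¬' a)      ≡⟨ ∧-distrib-∨ b a (¬' a) ⟩
      b ∧ a ∨ b ∧ ¬' a    ≤⟨ ∨-least x∧y≤y b∧¬a≤a ⟩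
      a                   ∎
      where
      b∧¬a≤a : b ∧ ¬' a ≤ a
      b∧¬a≤a = →≡𝟙⇒≤ (squares-cover-𝟙 (prelinearity a (¬' a))
        (residual⁺ (≤-trans (·-mono e₁²≤¬b x∧y≤x) (≤-trans →-mp 𝟘≤x)))
        (residual⁺ (≤-trans (·-mono x·y≤x x∧y≤y) →-mp)))

    ¬2×²∧[x∨¬x]≤¬x : ¬' ((2× a) ²) ∧ (a ∨ ¬' a) ≤ ¬' a
    ¬2×²∧[x∨¬x]≤¬x = begin
      ¬' b ∧ (a ∨ ¬' a)         ≡⟨ ∧-distrib-∨ (¬' b) a (¬' a) ⟩
      ¬' b ∧ a ∨ ¬' b ∧ ¬' a    ≤⟨ ∨-least ¬b∧a≤¬a x∧y≤y ⟩
      ¬' a                      ∎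
      where
      ¬b∧a≤¬a : ¬' b ∧ a ≤ ¬' a
      ¬b∧a≤¬a = →≡𝟙⇒≤ (squares-cover-𝟙 (prelinearity a (¬' a))
        (residual⁺ (≤-trans (·-mono x·y≤x x∧y≤y) →-mp))
        (residual⁺ (≤-trans (·-mono e₂²≤b x∧y≤x) (≤-trans x·¬x≤𝟘 𝟘≤x))))

  below-contradiction⇒≤𝟘 : ∀ {u t a} → BoolSkel mtl u → 2× t ≡ 𝟙 → u ∧ t ≤ a ∧ ¬' a → u ≤ 𝟘
  below-contradiction⇒≤𝟘 {u} {t} {a} bool-u 2t≡𝟙 p = begin
    u                     ≤⟨ BoolSkel⇒idempotent bool-u ⟩
    u · u                 ≤⟨ ·-mono u≤¬t² u≤¬t² ⟩
    ¬' (t ²) · ¬' (t ²)   ≤⟨ 2×≡𝟙⇒¬²≤𝟘 (2×-² 2t≡𝟙) ⟩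
    𝟘                     ∎
    where
    u·t≤a∧¬a : u · t ≤ a ∧ ¬' a
    u·t≤a∧¬a = ≤-trans x·y≤x∧y p
    u≤¬t² : u ≤ ¬' (t ²)
    u≤¬t² = residual⁺ (begin
      u · (t · t)        ≤⟨ ·-monoˡ (BoolSkel⇒idempotent bool-u) ⟩
      (u · u) · (t · t)  ≡⟨ interchange u u t t ⟩
      (u · t) · (u · t)  ≤⟨ ·-mono (≤-trans u·t≤a∧¬a x∧y≤x) (≤-trans u·t≤a∧¬a x∧y≤y) ⟩
      a · ¬' a           ≤⟨ x·¬x≤𝟘 ⟩
      𝟘                  ∎)

module RadicalFilter (A : SBPAlgebra) {𝔲 : Subset (SBPAlgebra.mtl A)}
                     (ult : IsUltrafilterOfB (SBPAlgebra.mtl A) 𝔲) where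
  open SBPAlgebra A hiding (_≤_)
  open MTLProperties mtl
  open SBPProperties A
  open UltrafilterOfB mtl ult
  open IsUltrafilterOfB ult
  open IsProperFilterOfB isFilter

  R-consistent : ∀ {a} → R[_] mtl 𝔲 a → ¬ R[_] mtl 𝔲 (¬' a)
  R-consistent a∈R ¬a∈R = proper (subst 𝔲 (≤𝟘⇒≡𝟘 u≤𝟘) u∈𝔲)
    where
    open Cover (R⇒Cover (meet a∈R ¬a∈R))
    u≤𝟘 : u ≤ 𝟘
    u≤𝟘 = below-contradiction⇒≤𝟘 (inB u∈𝔲) 2t≡𝟙 u∧t≤x

  R-complete : ∀ {a} → ¬ R[_] mtl 𝔲 (¬' a) → R[_] mtl 𝔲 a
  R-complete {a} ¬a∉R = ∈R 2a²∈𝔲 (x∨¬x-radical 𝟘≢𝟙) (2×²∧[x∨¬x]≤x a)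
    where
    2a²∈𝔲 : 𝔲 ((2× a) ²)
    2a²∈𝔲 = ¬∉⇒∈ (2×²-BoolSkel a)
      (λ ¬2a²∈𝔲 → ¬a∉R (∈R ¬2a²∈𝔲 (x∨¬x-radical 𝟘≢𝟙) (¬2×²∧[x∨¬x]≤¬x a)))

lemma4p18 : (A : SBPAlgebra) → (𝔲 : Subset (SBPAlgebra.mtl A)) →
            IsUltrafilterOfB (SBPAlgebra.mtl A) 𝔲 →
            ∀ a → (R[_] (SBPAlgebra.mtl A) 𝔲 a → _* (SBPAlgebra.mtl A) (R[_] (SBPAlgebra.mtl A) 𝔲) a)
                × (_* (SBPAlgebra.mtl A) (R[_] (SBPAlgebra.mtl A) 𝔲) a → R[_] (SBPAlgebra.mtl A) 𝔲 a)
lemma4p18 A 𝔲 ult a = R-consistent , R-complete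
  where open RadicalFilter A ult
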